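{- Let $A,B,C\subseteq[n]$. (i) If $A\,\underline{\lessdot}\,C$ and $B\,\underline{\lessdot}\,C$, then either $C\subset A\cup B$ or $A\cup B\,\underline{\lessdot}\,C$. (ii) If $C\,\underline{\lessdot}\,A$ and $C\,\underline{\lessdot}\,B$, then $C\,\underline{\lessdot}\,A\cup B$.
   Context: For $X,Y\subseteq[n]$ write $X\lessdot Y$ if $Y-X\neq\emptyset$ and $i<j$ for all $i\in X-Y$, $j\in Y-X$; write $X\,\underline{\lessdot}\,Y$ if $X\lessdot Y$ or $X=Y$. -}

module Defs where

open import Data.Nat using (ℕ)
open import Data.Fin using (Fin; _<_)
open import Data.Fin.Subset using (Subset; _∈_; _─_; Nonempty)
open import Data.Product using (_×_)
open import Data.Sum using (_⊎_)
open import Relation.Binary.PropositionalEquality using (_≡_)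

_⋖_ : ∀ {n} → Subset n → Subset n → Set
X ⋖ Y = Nonempty (Y ─ X) × (∀ i j → i ∈ (X ─ Y) → j ∈ (Y ─ X) → i < j)

_⋖̲_ : ∀ {n} → Subset n → Subset n → Set
X ⋖̲ Y = X ⋖ Y ⊎ X ≡ Y

module Submission where

-- Write  Separated R X Y  for "R i j whenever i ∈ X ─ Y and
-- j ∈ Y ─ X"; then X ⋖ Y is exactly  Nonempty (Y ─ X) × Separated _<_ X Y,
-- and X ⋖̲ Y always implies Separated _<_ X Y (for X = Y both differences are
-- empty).  The heart of the lemma is that separation is stable under union:
-- if A and B are both separated from C then so is A ∪ B, on either side.
-- (i) If C ─ (A ∪ B) is nonempty, this stability gives A ∪ B ⋖ C directly;
--     otherwise C ⊆ A ∪ B, so C is either a proper subset of A ∪ B or equal.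
-- (ii) If C = A = B then A ∪ B = C.  Otherwise one of A ─ C, B ─ C is
--     nonempty, hence so is (A ∪ B) ─ C, and stability gives C ⋖ A ∪ B.

open import Defs
open import Data.Nat using (ℕ)
open import Data.Fin using (Fin; _<_)
open import Data.Fin.Subset
  using (Subset; inside; outside; _∈_; _∉_; _∪_; _─_; _⊆_; _⊂_; Nonempty; Empty)
open import Data.Fin.Subset.Properties
  using (_∈?_; nonempty?; ⊆-refl; ⊆-antisym; p⊆p∪q; q⊆p∪q; x∈p∪q⁻; p─q⊆p; x∈p∧x∉q⇒x∈p─q; ∪-idem)
open import Data.Vec using (_∷_; here; there)
open import Data.Product using (_×_; _,_)
open import Data.Sum as Sum using (_⊎_; inj₁; inj₂)
open import Function using (flip)
open import Relation.Binary.Core using (Rel)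
open import Relation.Binary.PropositionalEquality using (_≡_; refl; sym)
open import Relation.Nullary using (yes; no)
open import Relation.Nullary.Negation using (contradiction)

private
  variable
    n : ℕ

x∈p─q⇒x∉q : ∀ (p q : Subset n) {x : Fin n} → x ∈ p ─ q → x ∉ q
x∈p─q⇒x∉q (_ ∷ p) (outside ∷ q) (there x∈p─q) (there x∈q) = x∈p─q⇒x∉q p q x∈p─q x∈q
x∈p─q⇒x∉q (_ ∷ p) (inside  ∷ q) (there x∈p─q) (there x∈q) = x∈p─q⇒x∉q p q x∈p─q x∈q

─-mono : ∀ {p p′ q q′ : Subset n} → p ⊆ p′ → q′ ⊆ q → p ─ q ⊆ p′ ─ q′
─-mono {p = p} {q = q} p⊆p′ q′⊆q x∈p─q =
  x∈p∧x∉q⇒x∈p─q (p⊆p′ (p─q⊆p p q x∈p─q)) (λ x∈q′ → x∈p─q⇒x∉q p q x∈p─q (q′⊆q x∈q′))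

Empty─⇒⊆ : ∀ (p q : Subset n) → Empty (p ─ q) → p ⊆ q
Empty─⇒⊆ p q p─q-empty {x} x∈p with x ∈? q
... | yes x∈q = x∈q
... | no  x∉q = contradiction (x , x∈p∧x∉q⇒x∈p─q x∈p x∉q) p─q-empty

⊆⇒⊂⊎≡ : ∀ {p q : Subset n} → p ⊆ q → p ⊂ q ⊎ p ≡ q
⊆⇒⊂⊎≡ {p = p} {q} p⊆q with nonempty? (q ─ p)
... | yes (x , x∈q─p) = inj₁ (p⊆q , x , p─q⊆p q p x∈q─p , x∈p─q⇒x∉q q p x∈q─p)
... | no  q─p-empty   = inj₂ (⊆-antisym p⊆q (Empty─⇒⊆ q p q─p-empty))

Separated : Rel (Fin n) _ → Subset n → Subset n → Set
Separated R X Y = ∀ i j → i ∈ X ─ Y → j ∈ Y ─ X → R i j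

⋖̲⇒Separated : ∀ {X Y : Subset n} → X ⋖̲ Y → Separated _<_ X Y
⋖̲⇒Separated (inj₁ (_ , separated)) = separated
⋖̲⇒Separated {X = X} (inj₂ refl) i _ i∈X─X _ =
  contradiction (p─q⊆p X X i∈X─X) (x∈p─q⇒x∉q X X i∈X─X)

Separated-flip : ∀ {R : Rel (Fin n) _} {X Y : Subset n} →
                 Separated R X Y → Separated (flip R) Y X
Separated-flip separated i j i∈Y─X j∈X─Y = separated j i j∈X─Y i∈Y─X

x∈p∪q─r⁻ : ∀ (p q r : Subset n) {x : Fin n} → x ∈ (p ∪ q) ─ r → x ∈ p ─ r ⊎ x ∈ q ─ r
x∈p∪q─r⁻ p q r x∈p∪q─r =
  Sum.map (λ x∈p → x∈p∧x∉q⇒x∈p─q x∈p x∉r) (λ x∈q → x∈p∧x∉q⇒x∈p─q x∈q x∉r)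
          (x∈p∪q⁻ p q (p─q⊆p (p ∪ q) r x∈p∪q─r))
  where x∉r = x∈p─q⇒x∉q (p ∪ q) r x∈p∪q─r

-- If A and B are both separated from C, so is A ∪ B: an element of
-- (A ∪ B) ─ C lies in A ─ C or in B ─ C, and C ─ (A ∪ B) is contained in
-- both C ─ A and C ─ B.
∪-Separatedˡ : ∀ {R : Rel (Fin n) _} {A B C : Subset n} →
               Separated R A C → Separated R B C → Separated R (A ∪ B) C
∪-Separatedˡ {A = A} {B} {C} sepA sepB i j i∈A∪B─C j∈C─A∪B
  with x∈p∪q─r⁻ A B C i∈A∪B─C
... | inj₁ i∈A─C = sepA i j i∈A─C (─-mono ⊆-refl (p⊆p∪q B) j∈C─A∪B)
... | inj₂ i∈B─C = sepB i j i∈B─C (─-mono ⊆-refl (q⊆p∪q A B) j∈C─A∪B)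

∪-Separatedʳ : ∀ {R : Rel (Fin n) _} {A B C : Subset n} →
               Separated R C A → Separated R C B → Separated R C (A ∪ B)
∪-Separatedʳ sepA sepB =
  Separated-flip (∪-Separatedˡ (Separated-flip sepA) (Separated-flip sepB))

∪-⋖̲-below : ∀ (A B C : Subset n) → A ⋖̲ C → B ⋖̲ C → C ⊂ (A ∪ B) ⊎ (A ∪ B) ⋖̲ C
∪-⋖̲-below A B C A⋖̲C B⋖̲C with nonempty? (C ─ (A ∪ B))
... | yes C─A∪B-nonempty =
  inj₂ (inj₁ (C─A∪B-nonempty , ∪-Separatedˡ (⋖̲⇒Separated A⋖̲C) (⋖̲⇒Separated B⋖̲C)))
... | no C─A∪B-empty with ⊆⇒⊂⊎≡ (Empty─⇒⊆ C (A ∪ B) C─A∪B-empty)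
...   | inj₁ C⊂A∪B = inj₁ C⊂A∪B
...   | inj₂ C≡A∪B = inj₂ (inj₂ (sym C≡A∪B))

∪-⋖-above : ∀ {A B C : Subset n} → C ⋖̲ A → C ⋖̲ B →
            Nonempty ((A ∪ B) ─ C) → C ⋖ (A ∪ B)
∪-⋖-above C⋖̲A C⋖̲B A∪B─C-nonempty =
  A∪B─C-nonempty , ∪-Separatedʳ (⋖̲⇒Separated C⋖̲A) (⋖̲⇒Separated C⋖̲B)

∪-⋖̲-above : ∀ (A B C : Subset n) → C ⋖̲ A → C ⋖̲ B → C ⋖̲ (A ∪ B)
∪-⋖̲-above A B C C⋖̲A@(inj₁ ((x , x∈A─C) , _)) C⋖̲B =
  inj₁ (∪-⋖-above C⋖̲A C⋖̲B (x , ─-mono (p⊆p∪q B) ⊆-refl x∈A─C))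
∪-⋖̲-above A B C C⋖̲A@(inj₂ refl) C⋖̲B@(inj₁ ((x , x∈B─C) , _)) =
  inj₁ (∪-⋖-above C⋖̲A C⋖̲B (x , ─-mono (q⊆p∪q A B) ⊆-refl x∈B─C))
∪-⋖̲-above A B C (inj₂ refl) (inj₂ refl) = inj₂ (sym (∪-idem C))

lemma4p2 : ∀ (n : ℕ) (A B C : Subset n) →
    ((A ⋖̲ C → B ⋖̲ C → (C ⊂ (A ∪ B)) ⊎ ((A ∪ B) ⋖̲ C))
    × (C ⋖̲ A → C ⋖̲ B → C ⋖̲ (A ∪ B)))
lemma4p2 n A B C = ∪-⋖̲-below A B C , ∪-⋖̲-above A B C
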